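{- Let $a\in\mathcal A$ be an atomic type. Then: (1) $\lambda y^\oslash.\lambda x^\oslash.y^\oslash x^\oslash\rhd_\eta\lambda y^\oslash.y^\oslash$; (2) $\lambda y^\oslash.y^\oslash:\langle()\vdash a\to a\rangle$ is derivable; (3) $\lambda y^\oslash.\lambda x^\oslash.y^\oslash x^\oslash:\langle()\vdash a\to a\rangle$ is not derivable. (Hence subject $\eta$-expansion fails for $\vdash$.)
   Context: Indexes: finite sequences of natural numbers ($\mathcal L_{\mathbb N}$), $\oslash$ empty, $i::L$ prepending $i$, $L_1\preceq L_2$ (also $L_2\succeq L_1$) iff $L_2=L_1::L_3$ for some $L_3$ (concatenation). Terms: over a countably infinite set $\mathcal V$, terms $\mathcal M$, free indexed variables $\mathrm{fv}$, degree $d$, joinability $\diamond$ defined simultaneously: $x^L\in\mathcal M$ ($\mathrm{fv}=\{x^L\}$, $d=L$); $MN\in\mathcal M$ when $d(M)\preceq d(N)$, $M\diamond N$ ($\mathrm{fv}$ union, $d(MN)=d(M)$); $\lambda x^L.M\in\mathcal M$ when $L\succeq d(M)$ ($\mathrm{fv}(M)\setminus\{x^L\}$, $d=d(M)$). $M\diamond N$ iff $x^L\in\mathrm{fv}(M)$, $x^K\in\mathrm{fv}(N)$ imply $L=K$. Terms modulo $\alpha$. $\rhd_\eta$: least relation compatible with abstraction and application containing $\lambda x^L.(Mx^L)\rhd_\eta M$ when $x^L\notin\mathrm{fv}(M)$. Lifting $(x^L)^{+i}=x^{i::L}$, $(M_1M_2)^{+i}=M_1^{+i}M_2^{+i}$,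 $(\lambda x^L.M)^{+i}=\lambda x^{i::L}.M^{+i}$. Types: atomic types $\mathcal A$, expansion variables $\overline e_0,\overline e_1,\dots$; $\mathbb T\subseteq\mathbb U$ with degree: $a\in\mathbb T$ ($d=\oslash$); $U\to T\in\mathbb T$ for $U\in\mathbb U,T\in\mathbb T$ ($d=\oslash$); $\omega^L\in\mathbb U$ ($d=L$); $U_1\sqcap U_2$ if $d(U_1)=d(U_2)$; $\overline e_iU$ ($d=i::d(U)$); modulo $\sqcap$ commutative, associative, idempotent, $\overline e_i(U_1\sqcap U_2)=\overline e_iU_1\sqcap\overline e_iU_2$, $\omega^L\sqcap U=U$ ($d(U)=L$), $\overline e_i\omega^K=\omega^{i::K}$. Environments: finite sets of declarations $x^L:U$ (at most one per $x^L$); $()$ empty; $\Gamma,\Delta$ disjoint union; $env^\omega_M$ assigns $\omega^L$ to each $x^L\in\mathrm{fv}(M)$; $\Gamma_1\sqcap\Gamma_2$ intersects types of common variables, keeps others; $\overline e_j\Gamma$ replaces $x^L:U$ by $x^{j::L}:\overline e_jU$; $\Gamma_1\diamond\Gamma_2$ iff $x^L\in\mathrm{dom}\,\Gamma_1$, $x^K\in\mathrm{dom}\,\Gamma_2$ imply $L=K$. Subtyping $\sqsubseteq$: least relation on types, environments and typings closed under reflexivity, transitivity, $U_1\sqcap U_2\sqsubseteq U_1$ ($d(U_1)=d(U_2)$), $U_1\sqcap U_2\sqsubseteq V_1\sqcap V_2$ if $U_i\sqsubseteq V_i$, $U_1\to T_1\sqsubseteq U_2\to T_2$ if $U_2\sqsubseteq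 U_1$, $T_1\sqsubseteq T_2$, $\overline e_iU_1\sqsubseteq\overline e_iU_2$ if $U_1\sqsubseteq U_2$, $\Gamma,y^L:U_1\sqsubseteq\Gamma,y^L:U_2$ if $U_1\sqsubseteq U_2$, $\langle\Gamma_1\vdash U_1\rangle\sqsubseteq\langle\Gamma_2\vdash U_2\rangle$ if $U_1\sqsubseteq U_2$, $\Gamma_2\sqsubseteq\Gamma_1$. Typing rules ($T\in\mathbb T$): (ax) $x^\oslash:\langle(x^\oslash:T)\vdash T\rangle$; ($\omega$) $M:\langle env^\omega_M\vdash\omega^{d(M)}\rangle$; ($\to_I$) $M:\langle\Gamma,(x^L:U)\vdash T\rangle\Rightarrow\lambda x^L.M:\langle\Gamma\vdash U\to T\rangle$; ($\to'_I$) $M:\langle\Gamma\vdash T\rangle$, $x^L\notin\mathrm{dom}\,\Gamma\Rightarrow\lambda x^L.M:\langle\Gamma\vdash\omega^L\to T\rangle$; ($\to_E$) $M_1:\langle\Gamma_1\vdash U\to T\rangle$, $M_2:\langle\Gamma_2\vdash U\rangle$, $\Gamma_1\diamond\Gamma_2\Rightarrow M_1M_2:\langle\Gamma_1\sqcap\Gamma_2\vdash T\rangle$; ($\sqcap_I$) $M:\langle\Gamma\vdash U_1\rangle$, $M:\langle\Gamma\vdash U_2\rangle\Rightarrow M:\langle\Gamma\vdash U_1\sqcap U_2\rangle$; ($e$) $M:\langle\Gamma\vdash U\rangle\Rightarrow M^{+j}:\langle\overline e_j\Gamma\vdash\overline e_jU\rangle$; ($\sqsubseteq$) $M:\langle\Gamma\vdash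 U\rangle$, $\langle\Gamma\vdash U\rangle\sqsubseteq\langle\Gamma'\vdash U'\rangle\Rightarrow M:\langle\Gamma'\vdash U'\rangle$. -}

module Defs where

open import Data.Nat using (ℕ; _≟_)
open import Data.List using (List; []; _∷_; _++_; map; filter; deduplicate)
open import Data.List.Membership.Propositional using (_∈_; _∉_)
open import Data.List.Relation.Unary.Unique.Propositional using (Unique)
open import Data.List.Relation.Binary.Permutation.Propositional using (_↭_)
open import Data.Maybe using (Maybe; just; nothing)
open import Data.Product using (Σ; ∃; _×_; _,_; proj₁; proj₂)
import Data.Product.Properties as PP
import Data.List.Properties as LP
open import Relation.Binary.PropositionalEquality using (_≡_)
open import Relation.Binary.Definitions using (DecidableEquality)
open import Relation.Nullary using (¬_; yes; no; ¬?)

Idx : Set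
Idx = List ℕ

_⪯_ : Idx → Idx → Set
L₁ ⪯ L₂ = ∃ λ L₃ → L₂ ≡ L₁ ++ L₃

IVar : Set
IVar = ℕ × Idx

_≟v_ : DecidableEquality IVar
_≟v_ = PP.≡-dec _≟_ (LP.≡-dec _≟_)

data Tm : Set where
  var : ℕ → Idx → Tm
  app : Tm → Tm → Tm
  lam : ℕ → Idx → Tm → Tm

fv : Tm → List IVar
fv (var x L)   = (x , L) ∷ []
fv (app M N)   = fv M ++ fv N
fv (lam x L M) = filter (λ v → ¬? (v ≟v (x , L))) (fv M)

deg : Tm → Idx
deg (var x L)   = L
deg (app M N)   = deg M
deg (lam x L M) = deg M

_◇_ : Tm → Tm → Set
M ◇ N = ∀ {x L K} → (x , L) ∈ fv M → (x , K) ∈ fv N → L ≡ K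

data Term : Tm → Set where
  var : ∀ {x L} → Term (var x L)
  app : ∀ {M N} → Term M → Term N → deg M ⪯ deg N → M ◇ N → Term (app M N)
  lam : ∀ {x L M} → Term M → deg M ⪯ L → Term (lam x L M)

lift : ℕ → Tm → Tm
lift i (var x L)   = var x (i ∷ L)
lift i (app M N)   = app (lift i M) (lift i N)
lift i (lam x L M) = lam x (i ∷ L) (lift i M)

vars : Tm → List IVar
vars (var x L)   = (x , L) ∷ []
vars (app M N)   = vars M ++ vars N
vars (lam x L M) = (x , L) ∷ vars M

swapV : IVar → IVar → IVar → IVar
swapV a b v with v ≟v a
... | yes _ = b
... | no _ with v ≟v b
...   | yes _ = a
...   | no _  = v

swapTm : IVar → IVar → Tm → Tm
swapTm a b (var x L) with swapV a b (x , L)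
... | (y , K) = var y K
swapTm a b (app M N) = app (swapTm a b M) (swapTm a b N)
swapTm a b (lam x L M) with swapV a b (x , L)
... | (y , K) = lam y K (swapTm a b M)

data _≈α_ : Tm → Tm → Set where
  var : ∀ {x L} → var x L ≈α var x L
  app : ∀ {M M′ N N′} → M ≈α M′ → N ≈α N′ → app M N ≈α app M′ N′
  lam : ∀ {x y L M N} (c : ℕ) → (c , L) ∉ vars M → (c , L) ∉ vars N →
        swapTm (x , L) (c , L) M ≈α swapTm (y , L) (c , L) N →
        lam x L M ≈α lam y L N

data _▷η_ : Tm → Tm → Set where
  eta  : ∀ {x L M} → (x , L) ∉ fv M → lam x L (app M (var x L)) ▷η M
  lamC : ∀ {x L M N} → M ▷η N → lam x L M ▷η lam x L N
  appL : ∀ {M M′ N} → M ▷η M′ → app M N ▷η app M′ N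
  appR : ∀ {M N N′} → N ▷η N′ → app M N ▷η app M N′

-- Types (raw syntax; taken modulo the equational theory _≃_ below)

infixr 5 _⇒_
infixl 6 _⊓_

data Ty : Set where
  at  : ℕ → Ty
  _⇒_ : Ty → Ty → Ty
  ω   : Idx → Ty
  _⊓_ : Ty → Ty → Ty
  ē   : ℕ → Ty → Ty

dT : Ty → Idx
dT (at a)  = []
dT (U ⇒ T) = []
dT (ω L)   = L
dT (U ⊓ V) = dT U
dT (ē i U) = i ∷ dT U

data IsT : Ty → Set where
  at  : ∀ {a} → IsT (at a)
  arr : ∀ {U T} → IsT (U ⇒ T)

data _≃_ : Ty → Ty → Set where
  refl   : ∀ {U} → U ≃ U
  sym    : ∀ {U V} → U ≃ V → V ≃ U
  trans  : ∀ {U V W} → U ≃ V → V ≃ W → U ≃ W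
  ⇒-cong : ∀ {U U′ T T′} → U ≃ U′ → T ≃ T′ → (U ⇒ T) ≃ (U′ ⇒ T′)
  ⊓-cong : ∀ {U U′ V V′} → U ≃ U′ → V ≃ V′ → (U ⊓ V) ≃ (U′ ⊓ V′)
  ē-cong : ∀ {i U U′} → U ≃ U′ → ē i U ≃ ē i U′
  comm   : ∀ {U V} → dT U ≡ dT V → (U ⊓ V) ≃ (V ⊓ U)
  assoc  : ∀ {U V W} → dT U ≡ dT V → dT V ≡ dT W → ((U ⊓ V) ⊓ W) ≃ (U ⊓ (V ⊓ W))
  idem   : ∀ {U} → (U ⊓ U) ≃ U
  dist   : ∀ {i U V} → dT U ≡ dT V → ē i (U ⊓ V) ≃ (ē i U ⊓ ē i V)
  unit   : ∀ {L U} → dT U ≡ L → (ω L ⊓ U) ≃ U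
  ēω     : ∀ {i K} → ē i (ω K) ≃ ω (i ∷ K)

InT : Ty → Set
InT T = Σ Ty λ T′ → T ≃ T′ × IsT T′

data WfU : Ty → Set where
  at   : ∀ {a} → WfU (at a)
  arr  : ∀ {U T} → WfU U → WfU T → InT T → WfU (U ⇒ T)
  om   : ∀ {L} → WfU (ω L)
  meet : ∀ {U V} → WfU U → WfU V → dT U ≡ dT V → WfU (U ⊓ V)
  ex   : ∀ {i U} → WfU U → WfU (ē i U)

data _⊑_ : Ty → Ty → Set where
  ≃⊑    : ∀ {U V} → U ≃ V → U ⊑ V
  trans : ∀ {U V W} → U ⊑ V → V ⊑ W → U ⊑ W
  ⊓E    : ∀ {U₁ U₂} → dT U₁ ≡ dT U₂ → (U₁ ⊓ U₂) ⊑ U₁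
  ⊓M    : ∀ {U₁ U₂ V₁ V₂} → dT U₁ ≡ dT U₂ → dT V₁ ≡ dT V₂ →
          U₁ ⊑ V₁ → U₂ ⊑ V₂ → (U₁ ⊓ U₂) ⊑ (V₁ ⊓ V₂)
  ⇒M    : ∀ {U₁ U₂ T₁ T₂} → InT T₁ → InT T₂ →
          U₂ ⊑ U₁ → T₁ ⊑ T₂ → (U₁ ⇒ T₁) ⊑ (U₂ ⇒ T₂)
  ēM    : ∀ {i U₁ U₂} → U₁ ⊑ U₂ → ē i U₁ ⊑ ē i U₂

-- Environments (finite sets of declarations, as duplicate-free lists
-- identified up to permutation)

Env : Set
Env = List (IVar × Ty)

dom : Env → List IVar
dom Γ = map proj₁ Γ

WfEnv : Env → Set
WfEnv Γ = Unique (dom Γ) × (∀ {v U} → (v , U) ∈ Γ → WfU U)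

lookupE : IVar → Env → Maybe Ty
lookupE v [] = nothing
lookupE v ((w , U) ∷ Γ) with v ≟v w
... | yes _ = just U
... | no _  = lookupE v Γ

removeE : IVar → Env → Env
removeE v Γ = filter (λ p → ¬? (proj₁ p ≟v v)) Γ

meetOpt : Ty → Maybe Ty → Ty
meetOpt U (just V) = U ⊓ V
meetOpt U nothing  = U

_⊓ₑ_ : Env → Env → Env
[] ⊓ₑ Γ₂ = Γ₂
((v , U) ∷ Γ₁) ⊓ₑ Γ₂ = (v , meetOpt U (lookupE v Γ₂)) ∷ (Γ₁ ⊓ₑ removeE v Γ₂)

ēEnv : ℕ → Env → Env
ēEnv j Γ = map (λ { ((x , L) , U) → ((x , j ∷ L) , ē j U) }) Γ

envω : Tm → Env
envω M = map (λ v → (v , ω (proj₂ v))) (deduplicate _≟v_ (fv M))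

_◇ₑ_ : Env → Env → Set
Γ₁ ◇ₑ Γ₂ = ∀ {x L K} → (x , L) ∈ dom Γ₁ → (x , K) ∈ dom Γ₂ → L ≡ K

data _⊑ₑ_ : Env → Env → Set where
  refl  : ∀ {Γ} → Γ ⊑ₑ Γ
  trans : ∀ {Γ Δ Θ} → Γ ⊑ₑ Δ → Δ ⊑ₑ Θ → Γ ⊑ₑ Θ
  perm  : ∀ {Γ Δ} → Γ ↭ Δ → Γ ⊑ₑ Δ      -- environments are sets
  upd   : ∀ {Γ y U₁ U₂} → y ∉ dom Γ → U₁ ⊑ U₂ → ((y , U₁) ∷ Γ) ⊑ₑ ((y , U₂) ∷ Γ)

data _∶⟨_⊢_⟩ : Tm → Env → Ty → Set where
  ax  : ∀ {x T} → WfU T → InT T → var x [] ∶⟨ ((x , []) , T) ∷ [] ⊢ T ⟩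
  ωr  : ∀ {M} → Term M → M ∶⟨ envω M ⊢ ω (deg M) ⟩
  ⇒I  : ∀ {Γ x L U T M} → Term (lam x L M) → InT T → (x , L) ∉ dom Γ →
        M ∶⟨ ((x , L) , U) ∷ Γ ⊢ T ⟩ → lam x L M ∶⟨ Γ ⊢ U ⇒ T ⟩
  ⇒I′ : ∀ {Γ x L T M} → Term (lam x L M) → InT T → (x , L) ∉ dom Γ →
        M ∶⟨ Γ ⊢ T ⟩ → lam x L M ∶⟨ Γ ⊢ ω L ⇒ T ⟩
  ⇒E  : ∀ {Γ₁ Γ₂ U T M₁ M₂} → Term (app M₁ M₂) → InT T →
        M₁ ∶⟨ Γ₁ ⊢ U ⇒ T ⟩ → M₂ ∶⟨ Γ₂ ⊢ U ⟩ → Γ₁ ◇ₑ Γ₂ →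
        app M₁ M₂ ∶⟨ Γ₁ ⊓ₑ Γ₂ ⊢ T ⟩
  ⊓I  : ∀ {Γ M U₁ U₂} → dT U₁ ≡ dT U₂ →
        M ∶⟨ Γ ⊢ U₁ ⟩ → M ∶⟨ Γ ⊢ U₂ ⟩ → M ∶⟨ Γ ⊢ U₁ ⊓ U₂ ⟩
  er  : ∀ {Γ M U} (j : ℕ) → M ∶⟨ Γ ⊢ U ⟩ → lift j M ∶⟨ ēEnv j Γ ⊢ ē j U ⟩
  ⊑r  : ∀ {Γ Γ′ M U U′} → M ∶⟨ Γ ⊢ U ⟩ → U ⊑ U′ → Γ′ ⊑ₑ Γ →
        WfU U′ → WfEnv Γ′ → M ∶⟨ Γ′ ⊢ U′ ⟩
  αr  : ∀ {Γ M N U} → M ≈α N → M ∶⟨ Γ ⊢ U ⟩ → N ∶⟨ Γ ⊢ U ⟩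

-- The specific terms (y = variable 0, x = variable 1, index ⊘ = [])

λyλx-yx : Tm
λyλx-yx = lam 0 [] (lam 1 [] (app (var 0 []) (var 1 [])))

λy-y : Tm
λy-y = lam 0 [] (var 0 [])

-- Part (3) is an invariant argument on derivations.  Call a type
-- *atomic-headed* if one of its top-level constituents (looking through
-- ⊓ and expansion variables) is an atomic type, and *atom-returning* if
-- one of its top-level constituents is an arrow whose target is
-- atomic-headed.  Both predicates are invariant under the type equations
-- and transfer from a supertype to a subtype; we prove this once for every
-- predicate that distributes over ⊓ as a disjunction, ignores expansions,
-- fails on ω, and is antitone on arrows.  By induction on derivations,
-- no abstraction gets an atomic-headed type (abstractions are typed by
-- arrows and ω), hence no double abstraction gets an atom-returning type
-- (the body of the outer abstraction is itself an abstraction).  Since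
-- a → a is atom-returning, λy.λx.yx cannot be typed with it.

module Submission where

open import Defs
open import Data.Nat using (ℕ)
open import Data.List using ([])
open import Data.List.Relation.Unary.Any using (here; there)
open import Data.Product using (_×_; _,_)
open import Data.Sum using (_⊎_; inj₁; inj₂; map; swap; assocʳ; assocˡ; reduce; fromInj₂)
open import Data.Unit using (⊤; tt)
open import Data.Empty using (⊥; ⊥-elim)
open import Function using (id; _∘_)
open import Relation.Nullary using (¬_)
open import Relation.Binary.PropositionalEquality using (refl)

record Constituentwise (P : Ty → Set) : Set where
  field
    meet⁺  : ∀ {U V} → P U ⊎ P V → P (U ⊓ V)
    meet⁻  : ∀ {U V} → P (U ⊓ V) → P U ⊎ P V
    exp⁺   : ∀ {i U} → P U → P (ē i U)
    exp⁻   : ∀ {i U} → P (ē i U) → P U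
    omega  : ∀ {L} → ¬ P (ω L)
    arrow  : ∀ {U₁ U₂ T₁ T₂} → U₂ ⊑ U₁ → T₁ ⊑ T₂ → P (U₂ ⇒ T₂) → P (U₁ ⇒ T₁)

module ConstituentwiseProperties {P : Ty → Set} (C : Constituentwise P) where
  open Constituentwise C

  drop-ω : ∀ {L U} → P (ω L ⊓ U) → P U
  drop-ω = fromInj₂ (⊥-elim ∘ omega) ∘ meet⁻

  -- invariance under ≃, in both directions at once (needed for sym)
  ≃-to   : ∀ {U V} → U ≃ V → P U → P V
  ≃-from : ∀ {U V} → U ≃ V → P V → P U

  ≃-to refl          = id
  ≃-to (sym p)       = ≃-from p
  ≃-to (trans p q)   = ≃-to q ∘ ≃-to p
  ≃-to (⇒-cong p q)  = arrow (≃⊑ p) (≃⊑ (sym q))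
  ≃-to (⊓-cong p q)  = meet⁺ ∘ map (≃-to p) (≃-to q) ∘ meet⁻
  ≃-to (ē-cong p)    = exp⁺ ∘ ≃-to p ∘ exp⁻
  ≃-to (comm _)      = meet⁺ ∘ swap ∘ meet⁻
  ≃-to (assoc _ _)   = meet⁺ ∘ map id meet⁺ ∘ assocʳ ∘ map meet⁻ id ∘ meet⁻
  ≃-to idem          = reduce ∘ meet⁻
  ≃-to (dist _)      = meet⁺ ∘ map exp⁺ exp⁺ ∘ meet⁻ ∘ exp⁻
  ≃-to (unit _)      = drop-ω
  ≃-to ēω            = ⊥-elim ∘ omega ∘ exp⁻

  ≃-from refl         = id
  ≃-from (sym p)      = ≃-to p
  ≃-from (trans p q)  = ≃-from p ∘ ≃-from q
  ≃-from (⇒-cong p q) = arrow (≃⊑ (sym p)) (≃⊑ q)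
  ≃-from (⊓-cong p q) = meet⁺ ∘ map (≃-from p) (≃-from q) ∘ meet⁻
  ≃-from (ē-cong p)   = exp⁺ ∘ ≃-from p ∘ exp⁻
  ≃-from (comm _)     = meet⁺ ∘ swap ∘ meet⁻
  ≃-from (assoc _ _)  = meet⁺ ∘ map meet⁺ id ∘ assocˡ ∘ map id meet⁻ ∘ meet⁻
  ≃-from idem         = meet⁺ ∘ inj₁
  ≃-from (dist _)     = exp⁺ ∘ meet⁺ ∘ map exp⁻ exp⁻ ∘ meet⁻
  ≃-from (unit _)     = meet⁺ ∘ inj₂
  ≃-from ēω           = ⊥-elim ∘ omega

  ⊑-antitone : ∀ {U V} → U ⊑ V → P V → P U
  ⊑-antitone (≃⊑ p)         = ≃-from p
  ⊑-antitone (trans p q)    = ⊑-antitone p ∘ ⊑-antitone q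
  ⊑-antitone (⊓E _)         = meet⁺ ∘ inj₁
  ⊑-antitone (⊓M _ _ p q)   = meet⁺ ∘ map (⊑-antitone p) (⊑-antitone q) ∘ meet⁻
  ⊑-antitone (⇒M _ _ p q)   = arrow p q
  ⊑-antitone (ēM p)         = exp⁺ ∘ ⊑-antitone p ∘ exp⁻

AtomHeaded : Ty → Set
AtomHeaded (at _)  = ⊤
AtomHeaded (_ ⇒ _) = ⊥
AtomHeaded (ω _)   = ⊥
AtomHeaded (U ⊓ V) = AtomHeaded U ⊎ AtomHeaded V
AtomHeaded (ē _ U) = AtomHeaded U

atomHeaded-constituentwise : Constituentwise AtomHeaded
atomHeaded-constituentwise = record
  { meet⁺ = id ; meet⁻ = id ; exp⁺ = id ; exp⁻ = id
  ; omega = λ () ; arrow = λ _ _ () }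

open ConstituentwiseProperties atomHeaded-constituentwise
  renaming (⊑-antitone to atomHeaded-⊑)
  using ()

AtomReturning : Ty → Set
AtomReturning (at _)  = ⊥
AtomReturning (_ ⇒ T) = AtomHeaded T
AtomReturning (ω _)   = ⊥
AtomReturning (U ⊓ V) = AtomReturning U ⊎ AtomReturning V
AtomReturning (ē _ U) = AtomReturning U

-- arrow antitonicity is covariance of the target, i.e. atomHeaded-⊑
atomReturning-constituentwise : Constituentwise AtomReturning
atomReturning-constituentwise = record
  { meet⁺ = id ; meet⁻ = id ; exp⁺ = id ; exp⁻ = id
  ; omega = λ () ; arrow = λ _ → atomHeaded-⊑ }

open ConstituentwiseProperties atomReturning-constituentwise
  renaming (⊑-antitone to atomReturning-⊑)
  using ()

data Abstraction : Tm → Set where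
  lam : ∀ {x L M} → Abstraction (lam x L M)

data DoubleAbstraction : Tm → Set where
  lam : ∀ {x L M} → Abstraction M → DoubleAbstraction (lam x L M)

-- Lifting, swapping and α-conversion preserve these shapes; we need them
-- backwards, from the conclusion of rules (e), (α) to their premises.
lift-reflects-abstraction : ∀ {j} M → Abstraction (lift j M) → Abstraction M
lift-reflects-abstraction (lam _ _ _) lam = lam

lift-reflects-double : ∀ {j} M → DoubleAbstraction (lift j M) → DoubleAbstraction M
lift-reflects-double (lam _ _ M) (lam p) = lam (lift-reflects-abstraction M p)

swap-preserves-abstraction : ∀ a b M → Abstraction M → Abstraction (swapTm a b M)
swap-preserves-abstraction a b (lam x L M) lam with swapV a b (x , L)
... | _ = lam

swap-reflects-abstraction : ∀ a b M → Abstraction (swapTm a b M) → Abstraction M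
swap-reflects-abstraction a b (var x L) p with swapV a b (x , L)
swap-reflects-abstraction a b (var x L) () | _
swap-reflects-abstraction a b (lam x L M) _ = lam

α-reflects-abstraction : ∀ {M N} → M ≈α N → Abstraction N → Abstraction M
α-reflects-abstraction (lam _ _ _ _) lam = lam

-- the bodies of α-equivalent abstractions agree after swapping with a
-- fresh variable, which does not change whether they are abstractions
α-reflects-double : ∀ {M N} → M ≈α N → DoubleAbstraction N → DoubleAbstraction M
α-reflects-double (lam {x} {y} {L} {M} {N} c _ _ p) (lam q) =
  lam (swap-reflects-abstraction (x , L) (c , L) M
        (α-reflects-abstraction p (swap-preserves-abstraction (y , L) (c , L) N q)))

-- An abstraction is only ever typed by arrows, ω, and their combinations.
abstraction-not-atomHeaded : ∀ {Γ M U} → M ∶⟨ Γ ⊢ U ⟩ → Abstraction M → ¬ AtomHeaded U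
abstraction-not-atomHeaded (ωr _)            _ ()
abstraction-not-atomHeaded (⇒I _ _ _ _)      _ ()
abstraction-not-atomHeaded (⇒I′ _ _ _ _)     _ ()
abstraction-not-atomHeaded (⊓I _ d e)        l (inj₁ h) = abstraction-not-atomHeaded d l h
abstraction-not-atomHeaded (⊓I _ d e)        l (inj₂ h) = abstraction-not-atomHeaded e l h
abstraction-not-atomHeaded (er {M = M} _ d)  l h = abstraction-not-atomHeaded d (lift-reflects-abstraction M l) h
abstraction-not-atomHeaded (⊑r d p _ _ _)    l h = abstraction-not-atomHeaded d l (atomHeaded-⊑ p h)
abstraction-not-atomHeaded (αr a d)          l h = abstraction-not-atomHeaded d (α-reflects-abstraction a l) h

-- A double abstraction never returns an atom-headed type: the target of an
-- arrow introduced by (→I)/(→I′) types the inner abstraction.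
double-not-atomReturning : ∀ {Γ M U} → M ∶⟨ Γ ⊢ U ⟩ → DoubleAbstraction M → ¬ AtomReturning U
double-not-atomReturning (ωr _)            _ ()
double-not-atomReturning (⇒I _ _ _ d)      (lam l) h = abstraction-not-atomHeaded d l h
double-not-atomReturning (⇒I′ _ _ _ d)     (lam l) h = abstraction-not-atomHeaded d l h
double-not-atomReturning (⊓I _ d e)        l (inj₁ h) = double-not-atomReturning d l h
double-not-atomReturning (⊓I _ d e)        l (inj₂ h) = double-not-atomReturning e l h
double-not-atomReturning (er {M = M} _ d)  l h = double-not-atomReturning d (lift-reflects-double M l) h
double-not-atomReturning (⊑r d p _ _ _)    l h = double-not-atomReturning d l (atomReturning-⊑ p h)
double-not-atomReturning (αr a d)          l h = double-not-atomReturning d (α-reflects-double a l) h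

lemma8 : (a : ℕ) →
    (λyλx-yx ▷η λy-y)
    × (λy-y ∶⟨ [] ⊢ at a ⇒ at a ⟩)
    × ¬ (λyλx-yx ∶⟨ [] ⊢ at a ⇒ at a ⟩)
lemma8 a = η-step , typing-λy-y , λ d → double-not-atomReturning d (lam lam) tt
  where
  a-is-type : InT (at a)
  a-is-type = at a , refl , at

  -- (1) contract  λx.yx  to  y  under the binder λy; y ≢ x, so x ∉ fv(y)
  η-step : λyλx-yx ▷η λy-y
  η-step = lamC (eta λ { (here ()) ; (there ()) })

  typing-λy-y : λy-y ∶⟨ [] ⊢ at a ⇒ at a ⟩
  typing-λy-y = ⇒I (lam var ([] , refl)) a-is-type (λ ()) (ax at a-is-type)
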